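{- Let $(\mathbf A,\Box)$ be an S4MV-algebra and $(\mathbf B,G,H)$ an S4$_t$MV-algebra. (1) If $h$ is an assignment of propositional variables into $\mathbf A$ and $\bar h$ is the assignment into $\mathbf A_\Box$ given by $\bar h(p)=\Box(h(p))$, then $\bar h(\varphi)=h(M(\varphi))$ for every $\mathcal{L}$-formula $\varphi$. (2) For every $\mathcal{L}$-formula $\varphi$, $\varphi\approx1$ is valid in $\mathbf A_\Box$ iff $M(\varphi)\approx1$ is valid in $\mathbf A$. (3) If $h$ is an assignment into $\mathbf B$ and $\bar h(p)=G(h(p))$ is the induced assignment into $\mathbf B_G$, then $\bar h(\varphi)=h(T(\varphi))$ for every $\mathcal{L}$-formula $\varphi$. (4) For every $\mathcal{L}$-formula $\varphi$, $\varphi\approx1$ is valid in $\mathbf B_G$ iff $T(\varphi)\approx1$ is valid in $\mathbf B$.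
   Context: $\mathcal{L}$ has binary connectives $\wedge,\vee,\cdot,\to$ and constants $0,1$. An S4MV-algebra is an MV-algebra with a unary operation $\Box$ that is a $\{\wedge,\cdot,0,1\}$-endomorphism and an interior operator. An S4$_t$MV-algebra is an MV-algebra with unary operations $G,H$, each a $\{\wedge,\cdot,0,1\}$-endomorphism and interior operator, such that $P(x)=\neg H(\neg x)$ (with $\neg x=x\to0$) satisfies $x\le G(y)\iff P(x)\le y$. For $\gamma\in\{\Box,G\}$ on an algebra $\mathbf C$, $\mathbf C_\gamma=(\gamma[C],\wedge_\gamma,\vee,\cdot,\to_\gamma,0,\gamma(1))$ with $x\wedge_\gamma y=\gamma(x\wedge y)$, $x\to_\gamma y=\gamma(x\to y)$. The translation $M$ from $\mathcal{L}$-formulas to $\mathcal{L}\cup\{\Box\}$-formulas: $M(p)=\Box p$ for variables $p$, $M(0)=0$, $M(1)=1$, $M(\varphi\star\psi)=M(\varphi)\star M(\psi)$ for $\star\in\{\wedge,\vee,\cdot\}$, $M(\varphi\to\psi)=\Box(M(\varphi)\to M(\psi))$. $T$ is defined identically with $G$ in place of $\Box$. Formulas are evaluated in $\mathbf C_\gamma$ using its operations. -}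

module Defs where

open import Level using (Level; _⊔_) renaming (suc to lsuc)
open import Data.Nat using (ℕ)
open import Data.Product using (Σ; ∃; _×_)
open import Relation.Binary.PropositionalEquality using (_≡_)
open import Function.Bundles using (_⇔_)

-- MV-algebras in the signature {∧, ∨, ·, →, 0, 1}.
-- Presented (term-equivalently) as bounded commutative integral
-- residuated lattices satisfying  x ∨ y = (x → y) → y.

record MVAlgebra (a : Level) : Set (lsuc a) where
  infixr 6 _⇒_
  infixl 7 _∧_ _∨_
  infixl 8 _·_
  field
    Carrier : Set a
    _∧_ _∨_ _·_ _⇒_ : Carrier → Carrier → Carrier
    𝟎 𝟏 : Carrier

  _≤_ : Carrier → Carrier → Set a
  x ≤ y = x ∧ y ≡ x

  infix 4 _≤_
  ¬_ : Carrier → Carrier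
  ¬ x = x ⇒ 𝟎

  field
    ∧-assoc : ∀ x y z → (x ∧ y) ∧ z ≡ x ∧ (y ∧ z)
    ∨-assoc : ∀ x y z → (x ∨ y) ∨ z ≡ x ∨ (y ∨ z)
    ∧-comm  : ∀ x y → x ∧ y ≡ y ∧ x
    ∨-comm  : ∀ x y → x ∨ y ≡ y ∨ x
    ∧-absorbs-∨ : ∀ x y → x ∧ (x ∨ y) ≡ x
    ∨-absorbs-∧ : ∀ x y → x ∨ (x ∧ y) ≡ x
    𝟎-least    : ∀ x → 𝟎 ≤ x
    𝟏-greatest : ∀ x → x ≤ 𝟏
    ·-assoc    : ∀ x y z → (x · y) · z ≡ x · (y · z)
    ·-comm     : ∀ x y → x · y ≡ y · x
    ·-identity : ∀ x → x · 𝟏 ≡ x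
    residuation : ∀ x y z → ((x · y) ≤ z) ⇔ (y ≤ (x ⇒ z))
    mv : ∀ x y → x ∨ y ≡ ((x ⇒ y) ⇒ y)

record IsS4Op {a : Level} (A : MVAlgebra a) (γ : MVAlgebra.Carrier A → MVAlgebra.Carrier A) : Set a where
  open MVAlgebra A
  field
    pres-∧ : ∀ x y → γ (x ∧ y) ≡ γ x ∧ γ y
    pres-· : ∀ x y → γ (x · y) ≡ γ x · γ y
    pres-𝟎 : γ 𝟎 ≡ 𝟎
    pres-𝟏 : γ 𝟏 ≡ 𝟏
    monotone    : ∀ x y → x ≤ y → γ x ≤ γ y
    deflationary : ∀ x → γ x ≤ x
    idempotent  : ∀ x → γ (γ x) ≡ γ x

record S4MV (a : Level) : Set (lsuc a) where
  field
    alg : MVAlgebra a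
  open MVAlgebra alg public
  field
    □ : Carrier → Carrier
    isS4 : IsS4Op alg □

record S4tMV (a : Level) : Set (lsuc a) where
  field
    alg : MVAlgebra a
  open MVAlgebra alg public
  field
    G H : Carrier → Carrier
    isS4-G : IsS4Op alg G
    isS4-H : IsS4Op alg H

  P : Carrier → Carrier
  P x = ¬ (H (¬ x))

  field
    adjoint : ∀ x y → (x ≤ G y) ⇔ (P x ≤ y)

Var : Set
Var = ℕ

data Fm : Set where
  var : Var → Fm
  `0 `1 : Fm
  _`∧_ _`∨_ _`·_ _`→_ : Fm → Fm → Fm

data FmB : Set where
  var : Var → FmB
  `0 `1 : FmB
  _`∧_ _`∨_ _`·_ _`→_ : FmB → FmB → FmB
  `□ : FmB → FmB

data FmT : Set where
  var : Var → FmT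
  `0 `1 : FmT
  _`∧_ _`∨_ _`·_ _`→_ : FmT → FmT → FmT
  `G `H : FmT → FmT

M : Fm → FmB
M (var p) = `□ (var p)
M `0 = `0
M `1 = `1
M (φ `∧ ψ) = M φ `∧ M ψ
M (φ `∨ ψ) = M φ `∨ M ψ
M (φ `· ψ) = M φ `· M ψ
M (φ `→ ψ) = `□ (M φ `→ M ψ)

T : Fm → FmT
T (var p) = `G (var p)
T `0 = `0
T `1 = `1
T (φ `∧ ψ) = T φ `∧ T ψ
T (φ `∨ ψ) = T φ `∨ T ψ
T (φ `· ψ) = T φ `· T ψ
T (φ `→ ψ) = `G (T φ `→ T ψ)

module _ {a : Level} (A : MVAlgebra a) where
  open MVAlgebra A

  eval : (Var → Carrier) → Fm → Carrier
  eval h (var p) = h p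
  eval h `0 = 𝟎
  eval h `1 = 𝟏
  eval h (φ `∧ ψ) = eval h φ ∧ eval h ψ
  eval h (φ `∨ ψ) = eval h φ ∨ eval h ψ
  eval h (φ `· ψ) = eval h φ · eval h ψ
  eval h (φ `→ ψ) = eval h φ ⇒ eval h ψ

  -- evaluation of L-formulas in C_γ = (γ[C], ∧_γ, ∨, ·, →_γ, 0, γ(1)).
  -- The operations of C_γ are the restrictions to γ[C] of the maps below;
  -- assignments into C_γ are assignments into C with values in γ[C].
  evalγ : (Carrier → Carrier) → (Var → Carrier) → Fm → Carrier
  evalγ γ h (var p) = h p
  evalγ γ h `0 = 𝟎
  evalγ γ h `1 = γ 𝟏
  evalγ γ h (φ `∧ ψ) = γ (evalγ γ h φ ∧ evalγ γ h ψ)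
  evalγ γ h (φ `∨ ψ) = evalγ γ h φ ∨ evalγ γ h ψ
  evalγ γ h (φ `· ψ) = evalγ γ h φ · evalγ γ h ψ
  evalγ γ h (φ `→ ψ) = γ (evalγ γ h φ ⇒ evalγ γ h ψ)

  IntoImage : (Carrier → Carrier) → (Var → Carrier) → Set a
  IntoImage γ v = ∀ p → ∃ λ y → v p ≡ γ y

  ValidIn-γ : (Carrier → Carrier) → Fm → Set a
  ValidIn-γ γ φ = ∀ (v : Var → Carrier) → IntoImage γ v → evalγ γ v φ ≡ γ 𝟏

module _ {a : Level} (A : S4MV a) where
  open S4MV A

  evalB : (Var → Carrier) → FmB → Carrier
  evalB h (var p) = h p
  evalB h `0 = 𝟎
  evalB h `1 = 𝟏
  evalB h (φ `∧ ψ) = evalB h φ ∧ evalB h ψ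
  evalB h (φ `∨ ψ) = evalB h φ ∨ evalB h ψ
  evalB h (φ `· ψ) = evalB h φ · evalB h ψ
  evalB h (φ `→ ψ) = evalB h φ ⇒ evalB h ψ
  evalB h (`□ φ) = □ (evalB h φ)

  ValidB : FmB → Set a
  ValidB ψ = ∀ (h : Var → Carrier) → evalB h ψ ≡ 𝟏

module _ {a : Level} (B : S4tMV a) where
  open S4tMV B

  evalT : (Var → Carrier) → FmT → Carrier
  evalT h (var p) = h p
  evalT h `0 = 𝟎
  evalT h `1 = 𝟏
  evalT h (φ `∧ ψ) = evalT h φ ∧ evalT h ψ
  evalT h (φ `∨ ψ) = evalT h φ ∨ evalT h ψ
  evalT h (φ `· ψ) = evalT h φ · evalT h ψ
  evalT h (φ `→ ψ) = evalT h φ ⇒ evalT h ψ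
  evalT h (`G φ) = G (evalT h φ)
  evalT h (`H φ) = H (evalT h φ)

  ValidT : FmT → Set a
  ValidT ψ = ∀ (h : Var → Carrier) → evalT h ψ ≡ 𝟏

-- A modal translation of φ evaluates to an element fixed by γ: γ fixes
-- variables γ(h p), 0, 1 and γ-images, and commutes with ∧ and ·; for ∨ one
-- uses that a join of γ-open elements is γ-open, since γ is monotone and
-- deflationary. Hence evaluating φ in C_γ under γ ∘ h computes the same value
-- as evaluating the translation under h: the extra γ that C_γ puts around ∧
-- is absorbed. Validity transfers because every assignment into γ[C] has the
-- form γ ∘ h, and the top element of C_γ is γ 1 = 1.
module Submission where

open import Defs
open import Level using (Level)
open import Data.Product using (_×_; _,_; proj₁; proj₂)
open import Function using (_∘_)
open import Function.Bundles using (_⇔_; mk⇔; Equivalence)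
open import Relation.Binary.PropositionalEquality
  using (_≡_; refl; sym; trans; cong; cong₂; subst)
open Relation.Binary.PropositionalEquality.≡-Reasoning

module LatticeProperties {a : Level} (A : MVAlgebra a) where
  open MVAlgebra A

  ≤-antisym : ∀ {x y} → x ≤ y → y ≤ x → x ≡ y
  ≤-antisym {x} {y} x≤y y≤x = trans (sym x≤y) (trans (∧-comm x y) y≤x)

  ≤⇒∨≡ʳ : ∀ {x z} → x ≤ z → x ∨ z ≡ z
  ≤⇒∨≡ʳ {x} {z} x≤z = begin
    x ∨ z        ≡⟨ cong (_∨ z) (sym x≤z) ⟩
    (x ∧ z) ∨ z  ≡⟨ ∨-comm (x ∧ z) z ⟩
    z ∨ (x ∧ z)  ≡⟨ cong (z ∨_) (∧-comm x z) ⟩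
    z ∨ (z ∧ x)  ≡⟨ ∨-absorbs-∧ z x ⟩
    z            ∎

  ∨-least : ∀ {x y z} → x ≤ z → y ≤ z → x ∨ y ≤ z
  ∨-least {x} {y} {z} x≤z y≤z = begin
    (x ∨ y) ∧ z              ≡⟨ cong ((x ∨ y) ∧_) (sym x∨y∨z≡z) ⟩
    (x ∨ y) ∧ ((x ∨ y) ∨ z)  ≡⟨ ∧-absorbs-∨ (x ∨ y) z ⟩
    x ∨ y                    ∎
    where
    x∨y∨z≡z : (x ∨ y) ∨ z ≡ z
    x∨y∨z≡z = trans (∨-assoc x y z)
      (trans (cong (x ∨_) (≤⇒∨≡ʳ y≤z)) (≤⇒∨≡ʳ x≤z))

  x≤x∨y : ∀ x y → x ≤ x ∨ y
  x≤x∨y = ∧-absorbs-∨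

  y≤x∨y : ∀ x y → y ≤ x ∨ y
  y≤x∨y x y = trans (cong (y ∧_) (∨-comm x y)) (∧-absorbs-∨ y x)

module Translation {a : Level} (A : MVAlgebra a) where
  open MVAlgebra A
  open LatticeProperties A

  -- The common value of M φ and T φ, with γ standing for □ resp. G.
  evalTr : (Carrier → Carrier) → (Var → Carrier) → Fm → Carrier
  evalTr γ h (var p)  = γ (h p)
  evalTr γ h `0       = 𝟎
  evalTr γ h `1       = 𝟏
  evalTr γ h (φ `∧ ψ) = evalTr γ h φ ∧ evalTr γ h ψ
  evalTr γ h (φ `∨ ψ) = evalTr γ h φ ∨ evalTr γ h ψ
  evalTr γ h (φ `· ψ) = evalTr γ h φ · evalTr γ h ψ
  evalTr γ h (φ `→ ψ) = γ (evalTr γ h φ ⇒ evalTr γ h ψ)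

  evalγ-cong : ∀ γ {v w : Var → Carrier} → (∀ p → v p ≡ w p) →
    ∀ φ → evalγ A γ v φ ≡ evalγ A γ w φ
  evalγ-cong γ v≗w (var p)  = v≗w p
  evalγ-cong γ v≗w `0       = refl
  evalγ-cong γ v≗w `1       = refl
  evalγ-cong γ v≗w (φ `∧ ψ) = cong γ (cong₂ _∧_ (evalγ-cong γ v≗w φ) (evalγ-cong γ v≗w ψ))
  evalγ-cong γ v≗w (φ `∨ ψ) = cong₂ _∨_ (evalγ-cong γ v≗w φ) (evalγ-cong γ v≗w ψ)
  evalγ-cong γ v≗w (φ `· ψ) = cong₂ _·_ (evalγ-cong γ v≗w φ) (evalγ-cong γ v≗w ψ)
  evalγ-cong γ v≗w (φ `→ ψ) = cong γ (cong₂ _⇒_ (evalγ-cong γ v≗w φ) (evalγ-cong γ v≗w ψ))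

  module _ {γ : Carrier → Carrier} (isS4 : IsS4Op A γ) where
    open IsS4Op isS4

    ∨-open : ∀ {x y} → γ x ≡ x → γ y ≡ y → γ (x ∨ y) ≡ x ∨ y
    ∨-open {x} {y} γx≡x γy≡y = ≤-antisym (deflationary (x ∨ y))
      (∨-least (subst (_≤ γ (x ∨ y)) γx≡x (monotone x (x ∨ y) (x≤x∨y x y)))
               (subst (_≤ γ (x ∨ y)) γy≡y (monotone y (x ∨ y) (y≤x∨y x y))))

    evalTr-open : ∀ h φ → γ (evalTr γ h φ) ≡ evalTr γ h φ
    evalTr-open h (var p)  = idempotent (h p)
    evalTr-open h `0       = pres-𝟎
    evalTr-open h `1       = pres-𝟏
    evalTr-open h (φ `∧ ψ) = trans (pres-∧ _ _) (cong₂ _∧_ (evalTr-open h φ) (evalTr-open h ψ))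
    evalTr-open h (φ `∨ ψ) = ∨-open (evalTr-open h φ) (evalTr-open h ψ)
    evalTr-open h (φ `· ψ) = trans (pres-· _ _) (cong₂ _·_ (evalTr-open h φ) (evalTr-open h ψ))
    evalTr-open h (φ `→ ψ) = idempotent _

    evalγ≡evalTr : ∀ h φ → evalγ A γ (γ ∘ h) φ ≡ evalTr γ h φ
    evalγ≡evalTr h (var p)  = refl
    evalγ≡evalTr h `0       = refl
    evalγ≡evalTr h `1       = pres-𝟏
    evalγ≡evalTr h (φ `∧ ψ) = begin
      γ (evalγ A γ (γ ∘ h) φ ∧ evalγ A γ (γ ∘ h) ψ)
        ≡⟨ cong γ (cong₂ _∧_ (evalγ≡evalTr h φ) (evalγ≡evalTr h ψ)) ⟩
      γ (evalTr γ h φ ∧ evalTr γ h ψ)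
        ≡⟨ evalTr-open h (φ `∧ ψ) ⟩
      evalTr γ h φ ∧ evalTr γ h ψ
        ∎
    evalγ≡evalTr h (φ `∨ ψ) = cong₂ _∨_ (evalγ≡evalTr h φ) (evalγ≡evalTr h ψ)
    evalγ≡evalTr h (φ `· ψ) = cong₂ _·_ (evalγ≡evalTr h φ) (evalγ≡evalTr h ψ)
    evalγ≡evalTr h (φ `→ ψ) = cong γ (cong₂ _⇒_ (evalγ≡evalTr h φ) (evalγ≡evalTr h ψ))

    validIn-γ⇔evalTr≡𝟏 : ∀ φ → ValidIn-γ A γ φ ⇔ (∀ h → evalTr γ h φ ≡ 𝟏)
    validIn-γ⇔evalTr≡𝟏 φ = mk⇔ to from
      where
      to : ValidIn-γ A γ φ → ∀ h → evalTr γ h φ ≡ 𝟏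
      to valid h = begin
        evalTr γ h φ         ≡⟨ sym (evalγ≡evalTr h φ) ⟩
        evalγ A γ (γ ∘ h) φ  ≡⟨ valid (γ ∘ h) (λ p → h p , refl) ⟩
        γ 𝟏                  ≡⟨ pres-𝟏 ⟩
        𝟏                    ∎

      from : (∀ h → evalTr γ h φ ≡ 𝟏) → ValidIn-γ A γ φ
      from valid v v∈γ[C] = begin
        evalγ A γ v φ        ≡⟨ evalγ-cong γ (proj₂ ∘ v∈γ[C]) φ ⟩
        evalγ A γ (γ ∘ h) φ  ≡⟨ evalγ≡evalTr h φ ⟩
        evalTr γ h φ         ≡⟨ valid h ⟩
        𝟏                    ≡⟨ sym pres-𝟏 ⟩
        γ 𝟏                  ∎
        where
        h : Var → Carrier
        h = proj₁ ∘ v∈γ[C]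

module _ {a : Level} (A : S4MV a) where
  open S4MV A
  open Translation alg

  evalB-M : ∀ h φ → evalB A h (M φ) ≡ evalTr □ h φ
  evalB-M h (var p)  = refl
  evalB-M h `0       = refl
  evalB-M h `1       = refl
  evalB-M h (φ `∧ ψ) = cong₂ _∧_ (evalB-M h φ) (evalB-M h ψ)
  evalB-M h (φ `∨ ψ) = cong₂ _∨_ (evalB-M h φ) (evalB-M h ψ)
  evalB-M h (φ `· ψ) = cong₂ _·_ (evalB-M h φ) (evalB-M h ψ)
  evalB-M h (φ `→ ψ) = cong □ (cong₂ _⇒_ (evalB-M h φ) (evalB-M h ψ))

  evalγ□≡evalB-M : ∀ h φ → evalγ alg □ (□ ∘ h) φ ≡ evalB A h (M φ)
  evalγ□≡evalB-M h φ = trans (evalγ≡evalTr isS4 h φ) (sym (evalB-M h φ))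

  validIn-□⇔validB-M : ∀ φ → ValidIn-γ alg □ φ ⇔ ValidB A (M φ)
  validIn-□⇔validB-M φ = mk⇔
    (λ valid h → trans (evalB-M h φ) (to valid h))
    (λ valid → from λ h → trans (sym (evalB-M h φ)) (valid h))
    where open Equivalence (validIn-γ⇔evalTr≡𝟏 isS4 φ)

module _ {a : Level} (B : S4tMV a) where
  open S4tMV B
  open Translation alg

  evalT-T : ∀ h φ → evalT B h (T φ) ≡ evalTr G h φ
  evalT-T h (var p)  = refl
  evalT-T h `0       = refl
  evalT-T h `1       = refl
  evalT-T h (φ `∧ ψ) = cong₂ _∧_ (evalT-T h φ) (evalT-T h ψ)
  evalT-T h (φ `∨ ψ) = cong₂ _∨_ (evalT-T h φ) (evalT-T h ψ)
  evalT-T h (φ `· ψ) = cong₂ _·_ (evalT-T h φ) (evalT-T h ψ)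
  evalT-T h (φ `→ ψ) = cong G (cong₂ _⇒_ (evalT-T h φ) (evalT-T h ψ))

  evalγG≡evalT-T : ∀ h φ → evalγ alg G (G ∘ h) φ ≡ evalT B h (T φ)
  evalγG≡evalT-T h φ = trans (evalγ≡evalTr isS4-G h φ) (sym (evalT-T h φ))

  validIn-G⇔validT-T : ∀ φ → ValidIn-γ alg G φ ⇔ ValidT B (T φ)
  validIn-G⇔validT-T φ = mk⇔
    (λ valid h → trans (evalT-T h φ) (to valid h))
    (λ valid → from λ h → trans (sym (evalT-T h φ)) (valid h))
    where open Equivalence (validIn-γ⇔evalTr≡𝟏 isS4-G φ)

lemma11 : ∀ {a b : Level} (A : S4MV a) (B : S4tMV b) →
    ((h : Var → S4MV.Carrier A) (φ : Fm) →
      evalγ (S4MV.alg A) (S4MV.□ A) (S4MV.□ A ∘ h) φ ≡ evalB A h (M φ))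
    × ((φ : Fm) → ValidIn-γ (S4MV.alg A) (S4MV.□ A) φ ⇔ ValidB A (M φ))
    × ((h : Var → S4tMV.Carrier B) (φ : Fm) →
      evalγ (S4tMV.alg B) (S4tMV.G B) (S4tMV.G B ∘ h) φ ≡ evalT B h (T φ))
    × ((φ : Fm) → ValidIn-γ (S4tMV.alg B) (S4tMV.G B) φ ⇔ ValidT B (T φ))
lemma11 A B =
  evalγ□≡evalB-M A , validIn-□⇔validB-M A , evalγG≡evalT-T B , validIn-G⇔validT-T B
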